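{- Let $G$ be a graph that has no strict bramble of order greater than $2$. Then $G$ contains none of $W_4$, $H_1$, $H_2$ as a minor.
   Context: A strict bramble of $G$ is a collection of vertex sets each inducing a connected subgraph of $G$, any two sharing a vertex; its order is the minimum size of a vertex set meeting all members. $W_4$: a 4-cycle plus a vertex adjacent to all its vertices. $H_1$: triangle $pqr$ plus three new vertices adjacent exactly to $\{p,q\}$, $\{q,r\}$, $\{r,p\}$ respectively. $H_2$: $K_4$ on $\{a,b,c,d\}$ with edges $ab$ and $ac$ each subdivided once. -}

module Defs where

open import Data.Nat using (ℕ; _≤_)
open import Data.Fin using (Fin; zero; suc; _≟_)
open import Data.Fin.Subset using (Subset; _∈_; ∣_∣)
open import Data.Bool using (Bool; true; false; _∧_; _∨_)
open import Data.List using (List; []; _∷_)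
open import Data.List.Membership.Propositional renaming (_∈_ to _∈ₗ_)
open import Data.List.Relation.Unary.All using (All)
open import Data.Product using (_×_; _,_; Σ; ∃; ∃-syntax)
open import Relation.Binary.PropositionalEquality using (_≡_; refl; cong₂; trans)
open import Relation.Nullary using (¬_)
open import Relation.Nullary.Decidable using (⌊_⌋)
open import Data.Bool.Properties using (∨-comm; ∧-comm)

record Graph : Set where
  field
    n      : ℕ
    adj    : Fin n → Fin n → Bool
    sym    : ∀ x y → adj x y ≡ adj y x
    irrefl : ∀ x → adj x x ≡ false

open Graph public

Adj : (G : Graph) → Fin (n G) → Fin (n G) → Set
Adj G x y = adj G x y ≡ true

data Walk (G : Graph) (X : Subset (n G)) : Fin (n G) → Fin (n G) → Set where
  here : ∀ {x} → x ∈ X → Walk G X x x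
  step : ∀ {x y z} → x ∈ X → Adj G x y → Walk G X y z → Walk G X x z

Connected : (G : Graph) → Subset (n G) → Set
Connected G X = (∃[ x ] x ∈ X) × (∀ x y → x ∈ X → y ∈ X → Walk G X x y)

StrictBramble : (G : Graph) → List (Subset (n G)) → Set
StrictBramble G 𝓑 =
  All (Connected G) 𝓑 ×
  (∀ X Y → X ∈ₗ 𝓑 → Y ∈ₗ 𝓑 → ∃[ v ] (v ∈ X × v ∈ Y))

Hits : (G : Graph) → List (Subset (n G)) → Subset (n G) → Set
Hits G 𝓑 S = ∀ X → X ∈ₗ 𝓑 → ∃[ v ] (v ∈ X × v ∈ S)

-- order of 𝓑 is > k  iff  every hitting set has size > k
OrderGreaterThan : (G : Graph) → List (Subset (n G)) → ℕ → Set
OrderGreaterThan G 𝓑 k = ∀ S → Hits G 𝓑 S → Data.Nat.suc k ≤ ∣ S ∣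

_IsMinorOf_ : Graph → Graph → Set
H IsMinorOf G =
  Σ (Fin (n H) → Subset (n G)) λ B →
    (∀ i → Connected G (B i)) ×
    (∀ i j v → v ∈ B i → v ∈ B j → i ≡ j) ×
    (∀ i j → Adj H i j → ∃[ u ] ∃[ v ] (u ∈ B i × v ∈ B j × Adj G u v))

edgeAdj : ∀ {k} → List (Fin k × Fin k) → Fin k → Fin k → Bool
edgeAdj [] u v = false
edgeAdj ((a , b) ∷ es) u v =
  ((⌊ u ≟ a ⌋ ∧ ⌊ v ≟ b ⌋) ∨ (⌊ u ≟ b ⌋ ∧ ⌊ v ≟ a ⌋)) ∨ edgeAdj es u v

edgeAdj-sym : ∀ {k} (es : List (Fin k × Fin k)) x y → edgeAdj es x y ≡ edgeAdj es y x
edgeAdj-sym [] x y = refl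
edgeAdj-sym ((a , b) ∷ es) x y =
  cong₂ _∨_ (trans (∨-comm (⌊ x ≟ a ⌋ ∧ ⌊ y ≟ b ⌋) (⌊ x ≟ b ⌋ ∧ ⌊ y ≟ a ⌋))
                   (cong₂ _∨_ (∧-comm ⌊ x ≟ b ⌋ ⌊ y ≟ a ⌋) (∧-comm ⌊ x ≟ a ⌋ ⌊ y ≟ b ⌋)))
            (edgeAdj-sym es x y)

pattern v0 = zero
pattern v1 = suc zero
pattern v2 = suc (suc zero)
pattern v3 = suc (suc (suc zero))
pattern v4 = suc (suc (suc (suc zero)))
pattern v5 = suc (suc (suc (suc (suc zero))))

-- W₄: 4-cycle 0-1-2-3-0 plus hub 4 adjacent to 0,1,2,3
W4-edges : List (Fin 5 × Fin 5)
W4-edges = (v0 , v1) ∷ (v1 , v2) ∷ (v2 , v3) ∷ (v3 , v0)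
         ∷ (v4 , v0) ∷ (v4 , v1) ∷ (v4 , v2) ∷ (v4 , v3) ∷ []

W4 : Graph
W4 = record { n = 5 ; adj = edgeAdj W4-edges ; sym = edgeAdj-sym W4-edges
            ; irrefl = λ { v0 → refl ; v1 → refl ; v2 → refl ; v3 → refl ; v4 → refl } }

-- H₁: triangle p=0,q=1,r=2; vertex 3 adj to {p,q}, 4 adj to {q,r}, 5 adj to {r,p}
H1-edges : List (Fin 6 × Fin 6)
H1-edges = (v0 , v1) ∷ (v1 , v2) ∷ (v2 , v0)
         ∷ (v3 , v0) ∷ (v3 , v1) ∷ (v4 , v1) ∷ (v4 , v2) ∷ (v5 , v2) ∷ (v5 , v0) ∷ []

H1 : Graph
H1 = record { n = 6 ; adj = edgeAdj H1-edges ; sym = edgeAdj-sym H1-edges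
            ; irrefl = λ { v0 → refl ; v1 → refl ; v2 → refl ; v3 → refl ; v4 → refl ; v5 → refl } }

-- H₂: K₄ on a=0,b=1,c=2,d=3 with ab subdivided by 4 and ac subdivided by 5
H2-edges : List (Fin 6 × Fin 6)
H2-edges = (v0 , v4) ∷ (v4 , v1) ∷ (v0 , v5) ∷ (v5 , v2)
         ∷ (v0 , v3) ∷ (v1 , v2) ∷ (v1 , v3) ∷ (v2 , v3) ∷ []

H2 : Graph
H2 = record { n = 6 ; adj = edgeAdj H2-edges ; sym = edgeAdj-sym H2-edges
            ; irrefl = λ { v0 → refl ; v1 → refl ; v2 → refl ; v3 → refl ; v4 → refl ; v5 → refl } }

-- A minor model of H in G turns every connected set of H into a connected set of G (the union of
-- its branch sets), and intersecting sets into intersecting sets. Each of W₄, H₁, H₂ carries a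
-- strict bramble in which every pair of vertices misses some member. Lifted to G, a hitting set of
-- the resulting bramble then needs three vertices in pairwise different branch sets, since after
-- hitting two branch sets there is still a member avoiding both. So G would have a strict bramble
-- of order greater than 2.
module Submission where

open import Defs hiding (sym)
open import Data.Bool using (true)
open import Data.Empty using (⊥-elim)
import Data.Bool.Properties as Bool
open import Data.Fin using (Fin; _≟_)
import Data.Fin.Properties as Fin
open import Data.Fin.Subset using (Subset; _∈_; _∪_; ⋃; _-_; ∣_∣)
open import Data.Fin.Subset.Properties
  using (x∈p∪q⁺; x∈p∪q⁻; ∉⊥; ∪-identityʳ; x∈p∧x≢y⇒x∈p-y; x∈p⇒∣p-x∣<∣p∣)
open import Data.List using (List; []; _∷_; map)
open import Data.List.Membership.Propositional using (find) renaming (_∈_ to _∈ₗ_; _∉_ to _∉ₗ_)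
open import Data.List.Membership.Propositional.Properties using (∈-map⁺; ∈-map⁻)
open import Data.List.Relation.Unary.All as All using (All)
open import Data.List.Relation.Unary.All.Properties as All using ()
open import Data.List.Relation.Unary.Any as Any using (Any; here; there)
open import Data.Nat using (_≤_; z≤n; s≤s)
open import Data.Nat.Properties using (≤-trans)
open import Data.Product using (_×_; _,_; ∃-syntax; proj₁)
open import Data.Sum using (inj₁; inj₂)
open import Relation.Binary.PropositionalEquality using (_≡_; _≢_; refl; trans; sym; subst)
open import Relation.Nullary using (¬_; Dec; yes; no; ¬?)
open import Relation.Nullary.Decidable using (map′; _×-dec_; from-yes)

three-elements⇒3≤∣p∣ : ∀ {k} {p : Subset k} {x y z} → x ∈ p → y ∈ p → z ∈ p →
                       y ≢ x → z ≢ x → z ≢ y → 3 ≤ ∣ p ∣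
three-elements⇒3≤∣p∣ x∈p y∈p z∈p y≢x z≢x z≢y =
  ≤-trans (s≤s (≤-trans (s≤s (≤-trans (s≤s z≤n) (x∈p⇒∣p-x∣<∣p∣ z∈p-x-y)))
                        (x∈p⇒∣p-x∣<∣p∣ y∈p-x)))
          (x∈p⇒∣p-x∣<∣p∣ x∈p)
  where
  y∈p-x = x∈p∧x≢y⇒x∈p-y y∈p y≢x
  z∈p-x-y = x∈p∧x≢y⇒x∈p-y (x∈p∧x≢y⇒x∈p-y z∈p z≢x) z≢y

module _ (G : Graph) where

  private variable
    X Y : Subset (n G)
    u v x y z : Fin (n G)

  adj-sym : Adj G x y → Adj G y x
  adj-sym {x} {y} xy = trans (sym (Graph.sym G x y)) xy

  walk-head : Walk G X x y → x ∈ X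
  walk-head (here x∈X)     = x∈X
  walk-head (step x∈X _ _) = x∈X

  walk-mono : (∀ {v} → v ∈ X → v ∈ Y) → Walk G X x y → Walk G Y x y
  walk-mono X⊆Y (here x∈X)       = here (X⊆Y x∈X)
  walk-mono X⊆Y (step x∈X xy w) = step (X⊆Y x∈X) xy (walk-mono X⊆Y w)

  walk-++ : Walk G X x y → Walk G X y z → Walk G X x z
  walk-++ (here _)        w′ = w′
  walk-++ (step x∈X xy w) w′ = step x∈X xy (walk-++ w w′)

  walk-reverse : Walk G X x y → Walk G X y x
  walk-reverse (here x∈X)       = here x∈X
  walk-reverse (step x∈X xy w) = walk-++ (walk-reverse w) (step (walk-head w) (adj-sym xy) (here x∈X))

  connected-via-hub : u ∈ X → (∀ x → x ∈ X → Walk G X x u) → Connected G X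
  connected-via-hub u∈X to-u = (_ , u∈X) , λ x y x∈X y∈X → walk-++ (to-u x x∈X) (walk-reverse (to-u y y∈X))

  ∪-connected : Connected G X → Connected G Y → u ∈ X → v ∈ Y → Adj G u v → Connected G (X ∪ Y)
  ∪-connected {X} {Y} {u} {v} (_ , walkX) (_ , walkY) u∈X v∈Y uv = connected-via-hub (inl u∈X) to-u
    where
    inl : ∀ {w} → w ∈ X → w ∈ X ∪ Y
    inl w∈X = x∈p∪q⁺ (inj₁ w∈X)
    inr : ∀ {w} → w ∈ Y → w ∈ X ∪ Y
    inr w∈Y = x∈p∪q⁺ (inj₂ w∈Y)
    to-u : ∀ x → x ∈ X ∪ Y → Walk G (X ∪ Y) x u
    to-u x x∈X∪Y with x∈p∪q⁻ X Y x∈X∪Y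
    ... | inj₁ x∈X = walk-mono inl (walkX x u x∈X u∈X)
    ... | inj₂ x∈Y = walk-++ (walk-mono inr (walkY x v x∈Y v∈Y)) (step (inr v∈Y) (adj-sym uv) (here (inl u∈X)))

-- Every vertex but the last is adjacent to a later one: a certificate that the list spans a
-- connected subgraph, checkable by computation.
data ConnectedList (H : Graph) : List (Fin (n H)) → Set where
  [_]    : ∀ i → ConnectedList H (i ∷ [])
  attach : ∀ {i is} → Any (Adj H i) is → ConnectedList H is → ConnectedList H (i ∷ is)

connectedList? : (H : Graph) → ∀ is → Dec (ConnectedList H is)
connectedList? H []                 = no λ ()
connectedList? H (i ∷ [])           = yes [ i ]
connectedList? H (i ∷ is@(_ ∷ _)) =
  map′ (λ (i~is , c) → attach i~is c) (λ { (attach i~is c) → i~is , c })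
       (Any.any? (λ j → adj H i j Bool.≟ true) is ×-dec connectedList? H is)

record PairAvoidingBramble (H : Graph) (L : List (List (Fin (n H)))) : Set where
  field
    members-connected : All (ConnectedList H) L
    members-touch     : All (λ A → All (λ A′ → Any (_∈ₗ A′) A) L) L
    avoids-pairs      : ∀ a b → Any (λ A → a ∉ₗ A × b ∉ₗ A) L

pairAvoidingBramble? : (H : Graph) → ∀ L → Dec (PairAvoidingBramble H L)
pairAvoidingBramble? H L =
  map′ (λ (c , t , a) → record { members-connected = c ; members-touch = t ; avoids-pairs = a })
       (λ β → let open PairAvoidingBramble β in members-connected , members-touch , avoids-pairs)
       (All.all? (connectedList? H) L ×-dec
        All.all? (λ A → All.all? (λ A′ → Any.any? (λ i → Any.any? (i ≟_) A′) A) L) L ×-dec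
        Fin.all? (λ a → Fin.all? (λ b →
          Any.any? (λ A → ¬? (Any.any? (a ≟_) A) ×-dec ¬? (Any.any? (b ≟_) A)) L)))

module MinorModel {G H : Graph} (B : Fin (n H) → Subset (n G))
  (branch-connected : ∀ i → Connected G (B i))
  (branch-disjoint  : ∀ i j v → v ∈ B i → v ∈ B j → i ≡ j)
  (branch-edge      : ∀ i j → Adj H i j → ∃[ u ] ∃[ v ] (u ∈ B i × v ∈ B j × Adj G u v)) where

  private variable
    i j : Fin (n H)
    is  : List (Fin (n H))
    v w : Fin (n G)

  lift : List (Fin (n H)) → Subset (n G)
  lift is = ⋃ (map B is)

  ∈-lift⁺ : i ∈ₗ is → v ∈ B i → v ∈ lift is
  ∈-lift⁺ (here refl) v∈Bi = x∈p∪q⁺ (inj₁ v∈Bi)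
  ∈-lift⁺ (there i∈is) v∈Bi = x∈p∪q⁺ (inj₂ (∈-lift⁺ i∈is v∈Bi))

  ∈-lift⁻ : v ∈ lift is → ∃[ i ] (i ∈ₗ is × v ∈ B i)
  ∈-lift⁻ {is = []} v∈⊥ = ⊥-elim (∉⊥ v∈⊥)
  ∈-lift⁻ {is = j ∷ is} v∈lift with x∈p∪q⁻ (B j) (lift is) v∈lift
  ... | inj₁ v∈Bj = j , here refl , v∈Bj
  ... | inj₂ v∈rest with ∈-lift⁻ v∈rest
  ... | i , i∈is , v∈Bi = i , there i∈is , v∈Bi

  lift-connected : ConnectedList H is → Connected G (lift is)
  lift-connected [ i ] = subst (Connected G) (sym (∪-identityʳ (B i))) (branch-connected i)
  lift-connected (attach {i} i~is c) with find i~is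
  ... | j , j∈is , ij with branch-edge i j ij
  ... | u , w , u∈Bi , w∈Bj , uw =
    ∪-connected G (branch-connected i) (lift-connected c) u∈Bi (∈-lift⁺ j∈is w∈Bj) uw

  distinct-branches : v ∈ B i → w ∈ B j → i ≢ j → v ≢ w
  distinct-branches v∈Bi w∈Bj i≢j refl = i≢j (branch-disjoint _ _ _ v∈Bi w∈Bj)

  module Lifted {L} (bramble : PairAvoidingBramble H L) where
    open PairAvoidingBramble bramble

    lifted : List (Subset (n G))
    lifted = map lift L

    lifted-strict : StrictBramble G lifted
    lifted-strict = All.map⁺ (All.map lift-connected members-connected) , touch
      where
      touch : ∀ X Y → X ∈ₗ lifted → Y ∈ₗ lifted → ∃[ v ] (v ∈ X × v ∈ Y)
      touch _ _ X∈ Y∈ with ∈-map⁻ lift X∈ | ∈-map⁻ lift Y∈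
      ... | A , A∈L , refl | A′ , A′∈L , refl with find (All.lookup (All.lookup members-touch A∈L) A′∈L)
      ... | i , i∈A , i∈A′ with proj₁ (branch-connected i)
      ... | v , v∈Bi = v , ∈-lift⁺ i∈A v∈Bi , ∈-lift⁺ i∈A′ v∈Bi

    hit-avoiding : ∀ {S} → Hits G lifted S → ∀ a b →
                   ∃[ i ] ∃[ v ] (i ≢ a × i ≢ b × v ∈ B i × v ∈ S)
    hit-avoiding hits a b with find (avoids-pairs a b)
    ... | A , A∈L , a∉A , b∉A with hits (lift A) (∈-map⁺ lift A∈L)
    ... | v , v∈A , v∈S with ∈-lift⁻ v∈A
    ... | i , i∈A , v∈Bi = i , v , (λ { refl → a∉A i∈A }) , (λ { refl → b∉A i∈A }) , v∈Bi , v∈S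

    -- The vertex a only serves to produce a first member of the bramble.
    lifted-order : Fin (n H) → OrderGreaterThan G lifted 2
    lifted-order a S hits with hit-avoiding hits a a
    ... | i₁ , v₁ , _ , _ , v₁∈B , v₁∈S with hit-avoiding hits i₁ i₁
    ... | i₂ , v₂ , i₂≢i₁ , _ , v₂∈B , v₂∈S with hit-avoiding hits i₁ i₂
    ... | i₃ , v₃ , i₃≢i₁ , i₃≢i₂ , v₃∈B , v₃∈S =
      three-elements⇒3≤∣p∣ v₁∈S v₂∈S v₃∈S (distinct-branches v₂∈B v₁∈B i₂≢i₁)
        (distinct-branches v₃∈B v₁∈B i₃≢i₁) (distinct-branches v₃∈B v₂∈B i₃≢i₂)

pairAvoidingBramble⇒¬minor : (G H : Graph) →
  (∀ (𝓑 : List (Subset (n G))) → StrictBramble G 𝓑 → ¬ OrderGreaterThan G 𝓑 2) →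
  ∀ {L} → PairAvoidingBramble H L → Fin (n H) → ¬ (H IsMinorOf G)
pairAvoidingBramble⇒¬minor G H noBramble bramble a (B , connected , disjoint , edge) =
  noBramble lifted lifted-strict (lifted-order a)
  where
  open MinorModel B connected disjoint edge
  open Lifted bramble

W4-members : List (List (Fin 5))
W4-members =
    (v2 ∷ v1 ∷ v0 ∷ []) ∷ (v3 ∷ v1 ∷ v0 ∷ []) ∷ (v4 ∷ v1 ∷ v0 ∷ []) ∷ (v2 ∷ v3 ∷ v0 ∷ [])
  ∷ (v2 ∷ v4 ∷ v0 ∷ []) ∷ (v4 ∷ v3 ∷ v0 ∷ []) ∷ (v3 ∷ v2 ∷ v1 ∷ []) ∷ (v4 ∷ v2 ∷ v1 ∷ [])
  ∷ (v3 ∷ v4 ∷ v1 ∷ []) ∷ (v4 ∷ v3 ∷ v2 ∷ []) ∷ []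

W4-bramble : PairAvoidingBramble W4 W4-members
W4-bramble = from-yes (pairAvoidingBramble? W4 W4-members)

H1-members : List (List (Fin 6))
H1-members =
    (v3 ∷ v2 ∷ v1 ∷ []) ∷ (v5 ∷ v4 ∷ v2 ∷ []) ∷ (v4 ∷ v3 ∷ v1 ∷ []) ∷ (v5 ∷ v3 ∷ v0 ∷ [])
  ∷ (v3 ∷ v2 ∷ v0 ∷ []) ∷ (v4 ∷ v1 ∷ v0 ∷ []) ∷ (v2 ∷ v1 ∷ v0 ∷ []) ∷ []

H1-bramble : PairAvoidingBramble H1 H1-members
H1-bramble = from-yes (pairAvoidingBramble? H1 H1-members)

H2-members : List (List (Fin 6))
H2-members =
    (v3 ∷ v2 ∷ v1 ∷ []) ∷ (v5 ∷ v3 ∷ v2 ∷ []) ∷ (v4 ∷ v3 ∷ v1 ∷ []) ∷ (v4 ∷ v2 ∷ v1 ∷ [])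
  ∷ (v4 ∷ v3 ∷ v0 ∷ []) ∷ (v2 ∷ v5 ∷ v4 ∷ v0 ∷ []) ∷ (v5 ∷ v1 ∷ v4 ∷ v0 ∷ [])
  ∷ (v1 ∷ v3 ∷ v0 ∷ []) ∷ (v1 ∷ v2 ∷ v5 ∷ v0 ∷ []) ∷ []

H2-bramble : PairAvoidingBramble H2 H2-members
H2-bramble = from-yes (pairAvoidingBramble? H2 H2-members)

mainTheorem8 : (G : Graph) →
    (∀ (𝓑 : List (Subset (n G))) → StrictBramble G 𝓑 → ¬ OrderGreaterThan G 𝓑 2) →
    ¬ (W4 IsMinorOf G) × ¬ (H1 IsMinorOf G) × ¬ (H2 IsMinorOf G)
mainTheorem8 G noBramble =
  pairAvoidingBramble⇒¬minor G W4 noBramble W4-bramble v0 ,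
  pairAvoidingBramble⇒¬minor G H1 noBramble H1-bramble v0 ,
  pairAvoidingBramble⇒¬minor G H2 noBramble H2-bramble v0
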